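{- For all integers $n \geq 2$, $k \geq 1$ and every $i \in \{0,\dots,k\}$, $$\mathfrak{z}_i(n,k) = (k+1)\,\mathfrak{z}_i(n-1,k) + (i+1)\sum_{j=i+1}^{k} \mathfrak{z}_j(n-1,k).$$
   Context: For $n\ge1$, $\mathsf{Tr}(n)$ is the set of words $u = u_1\cdots u_n$ over $\{0,1,2\}$ with $u_1 \neq 2$ and no indices $i<j$ with $u_i=0$, $u_j=1$, ordered componentwise ($u\preccurlyeq v$ iff $u_i\le v_i$ for all $i$). A $k$-chain is a sequence $(u^{(1)},\dots,u^{(k)})$ of elements of $\mathsf{Tr}(n)$ with $u^{(1)}\preccurlyeq\cdots\preccurlyeq u^{(k)}$ (repetitions allowed). For $i\in\{0,\dots,k\}$, $\mathcal{Z}_i(n,k)$ is the set of $k$-chains of $\mathsf{Tr}(n)$ such that $u^{(r)}$ contains the letter $0$ for all $r \le k-i$ and $u^{(s)}$ contains no letter $0$ for all $s > k-i$; $\mathfrak{z}_i(n,k) := \#\mathcal{Z}_i(n,k)$. -}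

module Defs where

open import Data.Nat using (ℕ; zero; suc; _+_; _∸_; _≤ᵇ_)
open import Data.Fin using (Fin; zero; suc; toℕ)
open import Data.Bool using (Bool; true; false; _∧_; _∨_; not)
open import Data.List using (List; []; _∷_; [_]; map; concatMap; filter; length; allFin; upTo)
open import Data.Nat.ListAction using (sum)
open import Data.Vec using (Vec; []; _∷_)
open import Relation.Nullary.Decidable using (Dec)
open import Data.Bool.Properties using (T?)
open import Relation.Binary.PropositionalEquality using (_≡_)

Letter : Set
Letter = Fin 3

Word : ℕ → Set
Word n = Vec Letter n

allVecs : {A : Set} → List A → (k : ℕ) → List (Vec A k)
allVecs xs zero = [ [] ]
allVecs xs (suc k) = concatMap (λ a → map (a ∷_) (allVecs xs k)) xs

allWords : (n : ℕ) → List (Word n)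
allWords n = allVecs (allFin 3) n

isZero isOne isTwo : Letter → Bool
isZero zero = true
isZero _ = false
isOne (suc zero) = true
isOne _ = false
isTwo (suc (suc zero)) = true
isTwo _ = false

hasOne : {n : ℕ} → Word n → Bool
hasOne [] = false
hasOne (a ∷ u) = isOne a ∨ hasOne u

hasZero : {n : ℕ} → Word n → Bool
hasZero [] = false
hasZero (a ∷ u) = isZero a ∨ hasZero u

noZeroBeforeOne : {n : ℕ} → Word n → Bool
noZeroBeforeOne [] = true
noZeroBeforeOne (a ∷ u) = (not (isZero a) ∨ not (hasOne u)) ∧ noZeroBeforeOne u

-- first letter is not 2 (Tr(n) is only considered for n ≥ 1)
firstNotTwo : {n : ℕ} → Word n → Bool
firstNotTwo [] = true
firstNotTwo (a ∷ u) = not (isTwo a)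

isTr : {n : ℕ} → Word n → Bool
isTr u = firstNotTwo u ∧ noZeroBeforeOne u

leqW : {n : ℕ} → Word n → Word n → Bool
leqW [] [] = true
leqW (a ∷ u) (b ∷ v) = (toℕ a ≤ᵇ toℕ b) ∧ leqW u v

allInTr : {n k : ℕ} → Vec (Word n) k → Bool
allInTr [] = true
allInTr (u ∷ us) = isTr u ∧ allInTr us

increasing : {n k : ℕ} → Vec (Word n) k → Bool
increasing [] = true
increasing (u ∷ []) = true
increasing (u ∷ v ∷ us) = leqW u v ∧ increasing (v ∷ us)

isChain : {n k : ℕ} → Vec (Word n) k → Bool
isChain c = allInTr c ∧ increasing c

zeroPattern : {n k : ℕ} → ℕ → Vec (Word n) k → Bool
zeroPattern m [] = true
zeroPattern zero (u ∷ us) = not (hasZero u) ∧ zeroPattern zero us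
zeroPattern (suc m) (u ∷ us) = hasZero u ∧ zeroPattern m us

inZ : (i n k : ℕ) → Vec (Word n) k → Bool
inZ i n k c = isChain c ∧ zeroPattern (k ∸ i) c

-- the set Z_i(n,k), as an explicit duplicate-free list
Zset : (i n k : ℕ) → List (Vec (Word n) k)
Zset i n k = filter (λ c → T? (inZ i n k c)) (allVecs (allWords n) k)

z : (i n k : ℕ) → ℕ
z i n k = length (Zset i n k)

sumFromTo : ℕ → ℕ → (ℕ → ℕ) → ℕ
sumFromTo a b f = sum (map (λ t → f (suc a + t)) (upTo (b ∸ a)))

module Submission where

-- Deleting the last letter of every word turns a k-chain of Tr(n) into a k-chain
-- c of Tr(n-1) plus a column x ∈ {0,1,2}^k of deleted letters; conversely c and x
-- give a chain of Tr(n) iff x is weakly increasing and a letter 1 is only put after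
-- a word without 0.  As c is increasing, its words containing 0 are its first t
-- words (c ∈ Z_{k-t}), and after appending x the first max(t, #zeros in x) words
-- contain 0.  Among admissible columns, those producing exactly s = k-i such words
-- number k+1 if t = s, i+1 if t < s and 0 if t > s; summing over c gives the result.

open import Defs
open import Data.Nat using (ℕ; zero; suc; _+_; _*_; _∸_; _≤_; z≤n; s≤s; _≤ᵇ_; _<ᵇ_; _≡ᵇ_; pred)
open import Data.Nat.Properties
  using (+-assoc; +-suc; +-identityʳ; *-identityˡ; *-zeroʳ; *-distribˡ-+; m∸n≤m; ∸-+-assoc;
         m∸[m∸n]≡n; pred-mono-≤; +-comm; *-comm; +-commutativeSemigroup)
open import Data.Nat.Tactic.RingSolver using (solve-∀)
open import Data.Fin using (zero; suc; toℕ)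
open import Data.Bool using (Bool; true; false; _∧_; _∨_; not)
open import Data.Bool.Properties
  using (T?; ∧-assoc; ∨-assoc; ∨-identityʳ; ∧-identityʳ; ∨-zeroʳ; ∧-zeroʳ;
         ∧-conicalˡ; ∧-conicalʳ; ∧-commutativeMonoid; ∧-idempotentCommutativeMonoid)
open import Data.List using (List; []; _∷_; map; concatMap; filter; length; allFin; upTo; applyUpTo; _++_)
open import Data.List.Properties using (map-upTo)
open import Data.Nat.ListAction using (sum)
open import Data.Vec using (Vec; []; _∷_; _∷ʳ_; zipWith)
import Data.Vec as Vec
open import Data.Product using (∃; _,_; _×_)
open import Algebra.Bundles using (CommutativeMonoid)
open import Algebra.Properties.CommutativeSemigroup using (interchange)
import Algebra.Solver.IdempotentCommutativeMonoid as ∧-Solver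
open import Relation.Binary.PropositionalEquality
open ≡-Reasoning

∧-interchange : ∀ a b c d → (a ∧ b) ∧ (c ∧ d) ≡ (a ∧ c) ∧ (b ∧ d)
∧-interchange = interchange (CommutativeMonoid.commutativeSemigroup ∧-commutativeMonoid)

open ∧-Solver ∧-idempotentCommutativeMonoid using (solve; _⊜_; _⊕_)

∑ : {A : Set} → List A → (A → ℕ) → ℕ
∑ [] f = 0
∑ (x ∷ xs) f = f x + ∑ xs f

sum-map : {A : Set} (xs : List A) (f : A → ℕ) → sum (map f xs) ≡ ∑ xs f
sum-map [] f = refl
sum-map (x ∷ xs) f = cong (f x +_) (sum-map xs f)

∑-cong : {A : Set} (xs : List A) {f g : A → ℕ} → (∀ x → f x ≡ g x) → ∑ xs f ≡ ∑ xs g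
∑-cong [] e = refl
∑-cong (x ∷ xs) e = cong₂ _+_ (e x) (∑-cong xs e)

∑-++ : {A : Set} (xs ys : List A) (f : A → ℕ) → ∑ (xs ++ ys) f ≡ ∑ xs f + ∑ ys f
∑-++ [] ys f = refl
∑-++ (x ∷ xs) ys f = trans (cong (f x +_) (∑-++ xs ys f)) (sym (+-assoc (f x) _ _))

∑-map : {A B : Set} (h : A → B) (xs : List A) (f : B → ℕ) → ∑ (map h xs) f ≡ ∑ xs (λ x → f (h x))
∑-map h [] f = refl
∑-map h (x ∷ xs) f = cong (f (h x) +_) (∑-map h xs f)

∑-concatMap : {A B : Set} (g : A → List B) (xs : List A) (f : B → ℕ) →
  ∑ (concatMap g xs) f ≡ ∑ xs (λ a → ∑ (g a) f)
∑-concatMap g [] f = refl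
∑-concatMap g (x ∷ xs) f =
  trans (∑-++ (g x) (concatMap g xs) f) (cong (∑ (g x) f +_) (∑-concatMap g xs f))

∑-+ : {A : Set} (xs : List A) (f g : A → ℕ) → ∑ xs (λ x → f x + g x) ≡ ∑ xs f + ∑ xs g
∑-+ [] f g = refl
∑-+ (x ∷ xs) f g =
  trans (cong (f x + g x +_) (∑-+ xs f g)) (interchange +-commutativeSemigroup (f x) (g x) _ _)

∑-* : {A : Set} (xs : List A) (c : ℕ) (f : A → ℕ) → ∑ xs (λ x → c * f x) ≡ c * ∑ xs f
∑-* [] c f = sym (*-zeroʳ c)
∑-* (x ∷ xs) c f = trans (cong (c * f x +_) (∑-* xs c f)) (sym (*-distribˡ-+ c (f x) _))

∑-zero : {A : Set} (xs : List A) → ∑ xs (λ _ → 0) ≡ 0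
∑-zero [] = refl
∑-zero (x ∷ xs) = ∑-zero xs

∑-swap : {A B : Set} (xs : List A) (ys : List B) (f : A → B → ℕ) →
  ∑ xs (λ a → ∑ ys (λ b → f a b)) ≡ ∑ ys (λ b → ∑ xs (λ a → f a b))
∑-swap [] ys f = sym (∑-zero ys)
∑-swap (x ∷ xs) ys f = trans (cong (∑ ys (f x) +_) (∑-swap xs ys f)) (sym (∑-+ ys (f x) _))

𝟙 : Bool → ℕ
𝟙 true = 1
𝟙 false = 0

𝟙-∧ : ∀ b c → 𝟙 (b ∧ c) ≡ 𝟙 b * 𝟙 c
𝟙-∧ true c = sym (*-identityˡ (𝟙 c))
𝟙-∧ false c = refl

length-filter : {A : Set} (p : A → Bool) (xs : List A) →
  length (filter (λ x → T? (p x)) xs) ≡ ∑ xs (λ x → 𝟙 (p x))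
length-filter p [] = refl
length-filter p (x ∷ xs) with p x
... | true = cong suc (length-filter p xs)
... | false = length-filter p xs

letters : List Letter
letters = allFin 3

∑-allVecs-suc : {A : Set} (xs : List A) (k : ℕ) (g : Vec A (suc k) → ℕ) →
  ∑ (allVecs xs (suc k)) g ≡ ∑ xs (λ a → ∑ (allVecs xs k) (λ v → g (a ∷ v)))
∑-allVecs-suc xs k g = trans (∑-concatMap _ xs g) (∑-cong xs (λ a → ∑-map (a ∷_) (allVecs xs k) g))

∑-allWords-∷ʳ : ∀ m (f : Word (suc m) → ℕ) →
  ∑ (allWords (suc m)) f ≡ ∑ (allWords m) (λ u → ∑ letters (λ a → f (u ∷ʳ a)))
∑-allWords-∷ʳ zero f = begin
  ∑ (allWords 1) f                     ≡⟨ ∑-allVecs-suc letters 0 f ⟩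
  ∑ letters (λ a → f (a ∷ []) + 0)     ≡⟨ ∑-cong letters (λ a → +-identityʳ (f (a ∷ []))) ⟩
  ∑ letters (λ a → f (a ∷ []))         ≡⟨ sym (+-identityʳ _) ⟩
  ∑ letters (λ a → f (a ∷ [])) + 0     ∎
∑-allWords-∷ʳ (suc m) f = begin
  ∑ (allWords (suc (suc m))) f
    ≡⟨ ∑-allVecs-suc letters (suc m) f ⟩
  ∑ letters (λ a → ∑ (allWords (suc m)) (λ v → f (a ∷ v)))
    ≡⟨ ∑-cong letters (λ a → ∑-allWords-∷ʳ m (λ v → f (a ∷ v))) ⟩
  ∑ letters (λ a → ∑ (allWords m) (λ u → ∑ letters (λ b → f (a ∷ (u ∷ʳ b)))))
    ≡⟨ sym (∑-allVecs-suc letters m (λ w → ∑ letters (λ b → f (w ∷ʳ b)))) ⟩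
  ∑ (allWords (suc m)) (λ w → ∑ letters (λ b → f (w ∷ʳ b))) ∎

extend : {m k : ℕ} → Vec (Word m) k → Vec Letter k → Vec (Word (suc m)) k
extend = zipWith _∷ʳ_

∑-tuples-extend : ∀ {m} k (f : Vec (Word (suc m)) k → ℕ) →
  ∑ (allVecs (allWords (suc m)) k) f ≡ ∑ (allVecs (allWords m) k) (λ c → ∑ (allVecs letters k) (λ x → f (extend c x)))
∑-tuples-extend zero f = cong (_+ 0) (sym (+-identityʳ _))
∑-tuples-extend {m} (suc k) f = begin
  ∑ (allVecs W' (suc k)) f
    ≡⟨ ∑-allVecs-suc W' k f ⟩
  ∑ W' (λ w → ∑ (allVecs W' k) (λ cs → f (w ∷ cs)))
    ≡⟨ ∑-cong W' (λ w → ∑-tuples-extend k (λ cs → f (w ∷ cs))) ⟩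
  ∑ W' (λ w → ∑ (allVecs W k) (λ c → ∑ X (λ x → f (w ∷ extend c x))))
    ≡⟨ ∑-allWords-∷ʳ m (λ w → ∑ (allVecs W k) (λ c → ∑ X (λ x → f (w ∷ extend c x)))) ⟩
  ∑ W (λ u → ∑ letters (λ a → ∑ (allVecs W k) (λ c → ∑ X (λ x → f ((u ∷ʳ a) ∷ extend c x)))))
    ≡⟨ ∑-cong W (λ u → ∑-swap letters (allVecs W k) (λ a c → ∑ X (λ x → f ((u ∷ʳ a) ∷ extend c x)))) ⟩
  ∑ W (λ u → ∑ (allVecs W k) (λ c → ∑ letters (λ a → ∑ X (λ x → f (extend (u ∷ c) (a ∷ x))))))
    ≡⟨ ∑-cong W (λ u → ∑-cong (allVecs W k) (λ c → sym (∑-allVecs-suc letters k (λ x → f (extend (u ∷ c) x))))) ⟩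
  ∑ W (λ u → ∑ (allVecs W k) (λ c → ∑ (allVecs letters (suc k)) (λ x → f (extend (u ∷ c) x))))
    ≡⟨ sym (∑-allVecs-suc W k (λ c → ∑ (allVecs letters (suc k)) (λ x → f (extend c x)))) ⟩
  ∑ (allVecs W (suc k)) (λ c → ∑ (allVecs letters (suc k)) (λ x → f (extend c x))) ∎
  where
  W = allWords m
  W' = allWords (suc m)
  X = allVecs letters k

hasZero-∷ʳ : ∀ {n} (u : Word n) a → hasZero (u ∷ʳ a) ≡ hasZero u ∨ isZero a
hasZero-∷ʳ [] a = ∨-identityʳ (isZero a)
hasZero-∷ʳ (b ∷ u) a = trans (cong (isZero b ∨_) (hasZero-∷ʳ u a)) (sym (∨-assoc (isZero b) _ _))

hasOne-∷ʳ : ∀ {n} (u : Word n) a → hasOne (u ∷ʳ a) ≡ hasOne u ∨ isOne a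
hasOne-∷ʳ [] a = ∨-identityʳ (isOne a)
hasOne-∷ʳ (b ∷ u) a = trans (cong (isOne b ∨_) (hasOne-∷ʳ u a)) (sym (∨-assoc (isOne b) _ _))

noZeroBeforeOne-∷ʳ : ∀ {n} (u : Word n) a →
  noZeroBeforeOne (u ∷ʳ a) ≡ noZeroBeforeOne u ∧ (not (isOne a) ∨ not (hasZero u))
noZeroBeforeOne-∷ʳ [] zero = refl
noZeroBeforeOne-∷ʳ [] (suc zero) = refl
noZeroBeforeOne-∷ʳ [] (suc (suc zero)) = refl
noZeroBeforeOne-∷ʳ (b ∷ u) a rewrite hasOne-∷ʳ u a | noZeroBeforeOne-∷ʳ u a =
  regroup (isZero b) (hasOne u) (isOne a) (noZeroBeforeOne u) (hasZero u)
  where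
  -- z, h, o, n, h₀ stand for: b = 0, u has a 1, a = 1, u is 0-before-1 free, u has a 0
  regroup : ∀ z h o n h₀ → (not z ∨ not (h ∨ o)) ∧ (n ∧ (not o ∨ not h₀)) ≡
                            ((not z ∨ not h) ∧ n) ∧ (not o ∨ not (z ∨ h₀))
  regroup false h o n h₀ = refl
  regroup true true o n h₀ = refl
  regroup true false true n h₀ = sym (∧-zeroʳ n)
  regroup true false false n h₀ = refl

isTr-∷ʳ : ∀ {n} (u : Word (suc n)) a → isTr (u ∷ʳ a) ≡ isTr u ∧ (not (isOne a) ∨ not (hasZero u))
isTr-∷ʳ (b ∷ u) a rewrite noZeroBeforeOne-∷ʳ (b ∷ u) a = sym (∧-assoc (not (isTwo b)) _ _)

leqW-∷ʳ : ∀ {n} (u v : Word n) a b → leqW (u ∷ʳ a) (v ∷ʳ b) ≡ leqW u v ∧ (toℕ a ≤ᵇ toℕ b)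
leqW-∷ʳ [] [] a b = ∧-identityʳ _
leqW-∷ʳ (x ∷ u) (y ∷ v) a b rewrite leqW-∷ʳ u v a b = sym (∧-assoc (toℕ x ≤ᵇ toℕ y) _ _)

-- onesAllowed p x: the letter 1 is appended only at positions whose flag in p
-- (the word contains a 0) is false.
onesAllowed : ∀ {k} → Vec Bool k → Vec Letter k → Bool
onesAllowed [] [] = true
onesAllowed (b ∷ p) (a ∷ x) = (not (isOne a) ∨ not b) ∧ onesAllowed p x

allInTr-extend : ∀ {m k} (c : Vec (Word (suc m)) k) (x : Vec Letter k) →
  allInTr (extend c x) ≡ allInTr c ∧ onesAllowed (Vec.map hasZero c) x
allInTr-extend [] [] = refl
allInTr-extend (u ∷ c) (a ∷ x) rewrite isTr-∷ʳ u a | allInTr-extend c x =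
  ∧-interchange (isTr u) _ (allInTr c) _

ascendingFrom : ∀ {k} → Letter → Vec Letter k → Bool
ascendingFrom lo [] = true
ascendingFrom lo (a ∷ x) = (toℕ lo ≤ᵇ toℕ a) ∧ ascendingFrom a x

increasing-extend-∷ : ∀ {n k} (u : Word n) (c : Vec (Word n) k) a (x : Vec Letter k) →
  increasing (extend (u ∷ c) (a ∷ x)) ≡ increasing (u ∷ c) ∧ ascendingFrom a x
increasing-extend-∷ u [] a [] = refl
increasing-extend-∷ u (v ∷ c) a (b ∷ x) =
  trans (cong₂ _∧_ (leqW-∷ʳ u v a b) (increasing-extend-∷ v c b x))
        (∧-interchange (leqW u v) _ (increasing (v ∷ c)) _)

increasing-extend : ∀ {n k} (c : Vec (Word n) k) (x : Vec Letter k) →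
  increasing (extend c x) ≡ increasing c ∧ ascendingFrom zero x
increasing-extend [] [] = refl
increasing-extend (u ∷ c) (a ∷ x) = increasing-extend-∷ u c a x

flagPattern : ∀ {k} → ℕ → Vec Bool k → Bool
flagPattern s [] = true
flagPattern zero (b ∷ p) = not b ∧ flagPattern zero p
flagPattern (suc s) (b ∷ p) = b ∧ flagPattern s p

zeroPattern-flags : ∀ {n k} s (c : Vec (Word n) k) → zeroPattern s c ≡ flagPattern s (Vec.map hasZero c)
zeroPattern-flags s [] = refl
zeroPattern-flags zero (u ∷ c) = cong (not (hasZero u) ∧_) (zeroPattern-flags zero c)
zeroPattern-flags (suc s) (u ∷ c) = cong (hasZero u ∧_) (zeroPattern-flags s c)

zeroFlags : ∀ {k} → Vec Bool k → Vec Letter k → Vec Bool k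
zeroFlags = zipWith (λ b a → b ∨ isZero a)

hasZero-extend : ∀ {n k} (c : Vec (Word n) k) (x : Vec Letter k) →
  Vec.map hasZero (extend c x) ≡ zeroFlags (Vec.map hasZero c) x
hasZero-extend [] [] = refl
hasZero-extend (u ∷ c) (a ∷ x) = cong₂ _∷_ (hasZero-∷ʳ u a) (hasZero-extend c x)

admissible : ∀ {k} → Letter → ℕ → Vec Bool k → Vec Letter k → Bool
admissible lo s p x = (ascendingFrom lo x ∧ onesAllowed p x) ∧ flagPattern s (zeroFlags p x)

chain-extend : ∀ {m k} s (c : Vec (Word (suc m)) k) (x : Vec Letter k) →
  isChain (extend c x) ∧ zeroPattern s (extend c x) ≡ isChain c ∧ admissible zero s (Vec.map hasZero c) x
chain-extend s c x = begin
  isChain (extend c x) ∧ zeroPattern s (extend c x)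
    ≡⟨ cong₂ _∧_ (cong₂ _∧_ (allInTr-extend c x) (increasing-extend c x))
                 (trans (zeroPattern-flags s (extend c x)) (cong (flagPattern s) (hasZero-extend c x))) ⟩
  ((allInTr c ∧ O) ∧ (increasing c ∧ A)) ∧ F
    ≡⟨ regroup (allInTr c) O (increasing c) A F ⟩
  (allInTr c ∧ increasing c) ∧ ((A ∧ O) ∧ F) ∎
  where
  O = onesAllowed (Vec.map hasZero c) x
  A = ascendingFrom zero x
  F = flagPattern s (zeroFlags (Vec.map hasZero c) x)
  regroup : ∀ t o i a f → ((t ∧ o) ∧ (i ∧ a)) ∧ f ≡ (t ∧ i) ∧ ((a ∧ o) ∧ f)
  regroup = solve 5 (λ t o i a f → ((t ⊕ o) ⊕ (i ⊕ a)) ⊕ f ⊜ (t ⊕ i) ⊕ ((a ⊕ o) ⊕ f)) refl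

leadFlag : ℕ → Bool → Bool
leadFlag zero q = not q
leadFlag (suc _) q = q

firstFits : Letter → ℕ → Bool → Letter → Bool
firstFits lo s b a = ((toℕ lo ≤ᵇ toℕ a) ∧ (not (isOne a) ∨ not b)) ∧ leadFlag s (b ∨ isZero a)

admissible-∷ : ∀ {k} lo s b (p : Vec Bool k) a x →
  admissible lo s (b ∷ p) (a ∷ x) ≡ firstFits lo s b a ∧ admissible a (pred s) p x
admissible-∷ lo s b p a x = trans (cong (_ ∧_) (flagPattern-∷ s)) (regroup (toℕ lo ≤ᵇ toℕ a) _ _ _ _ _)
  where
  flagPattern-∷ : ∀ s → flagPattern s (zeroFlags (b ∷ p) (a ∷ x)) ≡
                        leadFlag s (b ∨ isZero a) ∧ flagPattern (pred s) (zeroFlags p x)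
  flagPattern-∷ zero = refl
  flagPattern-∷ (suc s) = refl
  regroup : ∀ l i o₁ o f₁ f → ((l ∧ i) ∧ (o₁ ∧ o)) ∧ (f₁ ∧ f) ≡ ((l ∧ o₁) ∧ f₁) ∧ ((i ∧ o) ∧ f)
  regroup = solve 6 (λ l i o₁ o f₁ f →
    ((l ⊕ i) ⊕ (o₁ ⊕ o)) ⊕ (f₁ ⊕ f) ⊜ ((l ⊕ o₁) ⊕ f₁) ⊕ ((i ⊕ o) ⊕ f)) refl

columnCount : ∀ {k} → Letter → ℕ → Vec Bool k → ℕ
columnCount {k} lo s p = ∑ (allVecs letters k) (λ x → 𝟙 (admissible lo s p x))

columnCount-∷ : ∀ {k} lo s b (p : Vec Bool k) →
  columnCount lo s (b ∷ p) ≡ ∑ letters (λ a → 𝟙 (firstFits lo s b a) * columnCount a (pred s) p)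
columnCount-∷ {k} lo s b p = trans (∑-allVecs-suc letters k _) (∑-cong letters (λ a → begin
  ∑ X (λ x → 𝟙 (admissible lo s (b ∷ p) (a ∷ x)))
    ≡⟨ ∑-cong X (λ x → trans (cong 𝟙 (admissible-∷ lo s b p a x)) (𝟙-∧ (firstFits lo s b a) _)) ⟩
  ∑ X (λ x → 𝟙 (firstFits lo s b a) * 𝟙 (admissible a (pred s) p x))
    ≡⟨ ∑-* X (𝟙 (firstFits lo s b a)) _ ⟩
  𝟙 (firstFits lo s b a) * columnCount a (pred s) p ∎))
  where
  X = allVecs letters k

stepPattern : (k t : ℕ) → Vec Bool k
stepPattern zero t = []
stepPattern (suc k) t = (0 <ᵇ t) ∷ stepPattern k (pred t)

-- columnFormula lo s t k: the number of admissible columns for lower bound lo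
-- when the first t of k words contain 0 and the first s should contain 0.
-- From lo = 0 the column is 0^p 1^q 2^r: if t = s then either p < t (and the
-- rest is 2) or p = t (and 1^q 2^r is free): k+1 columns; if t < s then p = s:
-- k-s+1 columns.  From lo = 1 no new 0 appears, and 1s are forbidden unless
-- t = 0; from lo = 2 the column is constant 2.
columnFormula : Letter → ℕ → ℕ → ℕ → ℕ
columnFormula zero s t k = 𝟙 (s ≡ᵇ t) * suc k + 𝟙 (t <ᵇ s) * suc (k ∸ s)
columnFormula (suc zero) zero zero k = suc k
columnFormula (suc zero) zero (suc t) k = 0
columnFormula (suc zero) (suc s) zero k = 0
columnFormula (suc zero) (suc s) (suc t) k = 𝟙 (s ≡ᵇ t)
columnFormula (suc (suc zero)) s t k = 𝟙 (s ≡ᵇ t)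

-- A letter sum in which only the letter 2 contributes, with value e.
onlyTwo : ∀ e → e ≡ 0 + (0 + (1 * e + 0))
onlyTwo = solve-∀

-- Each case is decided by evaluating firstFits on the three letters; the
-- surviving terms appear as 1 · … and 0 · …, normalised by the ring solver.
columnFormula-step : ∀ lo s t k → columnFormula lo s t (suc k) ≡
  ∑ letters (λ a → 𝟙 (firstFits lo s (0 <ᵇ t) a) * columnFormula a (pred s) (pred t) k)
columnFormula-step zero zero zero k = arith k
  where
  -- letters 1 (then 1^q 2^r: k+1 ways) and 2 (then all 2) are allowed
  arith : ∀ k → 1 * suc (suc k) + 0 * suc (suc k) ≡ 0 * 1 + (1 * suc k + (1 * 1 + 0))
  arith = solve-∀
columnFormula-step zero zero (suc t) k = refl
columnFormula-step zero (suc zero) zero k = arith k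
  where
  arith : ∀ k → 0 + 1 * suc k ≡ 1 * (1 * suc k + 0 * suc k) + (0 + (0 + 0))
  arith = solve-∀
columnFormula-step zero (suc (suc s)) zero k = arith (k ∸ suc s)
  where
  arith : ∀ m → 0 + 1 * suc m ≡ 1 * (0 + 1 * suc m) + (0 + (0 + 0))
  arith = solve-∀
columnFormula-step zero (suc s) (suc t) k = arith k (𝟙 (s ≡ᵇ t)) (𝟙 (t <ᵇ s)) (k ∸ s)
  where
  -- letters 0 (from lower bound 0) and 2 (then all 2, only if s = t) are allowed
  arith : ∀ k e l m → e * suc (suc k) + l * suc m ≡ 1 * (e * suc k + l * suc m) + (0 + (1 * e + 0))
  arith = solve-∀
columnFormula-step (suc zero) zero zero k = arith k
  where
  arith : ∀ k → suc (suc k) ≡ 0 * 1 + (1 * suc k + (1 * 1 + 0))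
  arith = solve-∀
columnFormula-step (suc zero) zero (suc t) k = refl
columnFormula-step (suc zero) (suc s) zero k = refl
columnFormula-step (suc zero) (suc s) (suc t) k = onlyTwo (𝟙 (s ≡ᵇ t))
columnFormula-step (suc (suc zero)) zero zero k = refl
columnFormula-step (suc (suc zero)) zero (suc t) k = refl
columnFormula-step (suc (suc zero)) (suc s) zero k = refl
columnFormula-step (suc (suc zero)) (suc s) (suc t) k = onlyTwo (𝟙 (s ≡ᵇ t))

columnCount-formula : ∀ k lo s t → s ≤ k → t ≤ k → columnCount lo s (stepPattern k t) ≡ columnFormula lo s t k
columnCount-formula zero zero zero zero z≤n z≤n = refl
columnCount-formula zero (suc zero) zero zero z≤n z≤n = refl
columnCount-formula zero (suc (suc zero)) zero zero z≤n z≤n = refl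
columnCount-formula (suc k) lo s t s≤k t≤k = begin
  columnCount lo s (stepPattern (suc k) t)
    ≡⟨ columnCount-∷ lo s (0 <ᵇ t) (stepPattern k (pred t)) ⟩
  ∑ letters (λ a → 𝟙 (firstFits lo s (0 <ᵇ t) a) * columnCount a (pred s) (stepPattern k (pred t)))
    ≡⟨ ∑-cong letters (λ a → cong (𝟙 (firstFits lo s (0 <ᵇ t) a) *_)
         (columnCount-formula k a (pred s) (pred t) (pred-mono-≤ s≤k) (pred-mono-≤ t≤k))) ⟩
  ∑ letters (λ a → 𝟙 (firstFits lo s (0 <ᵇ t) a) * columnFormula a (pred s) (pred t) k)
    ≡⟨ sym (columnFormula-step lo s t k) ⟩
  columnFormula lo s t (suc k) ∎

hasZero-antitone : ∀ {n} (u v : Word n) → leqW u v ≡ true → hasZero v ≡ true → hasZero u ≡ true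
hasZero-antitone (zero ∷ u) (zero ∷ v) _ _ = refl
hasZero-antitone (suc a ∷ u) (zero ∷ v) () _
hasZero-antitone (a ∷ u) (suc b ∷ v) u≼v v₀ rewrite hasZero-antitone u v (∧-conicalʳ _ _ u≼v) v₀ =
  ∨-zeroʳ (isZero a)

chain-stepPattern : ∀ {n k} (c : Vec (Word n) k) → increasing c ≡ true →
  ∃ λ t → t ≤ k × Vec.map hasZero c ≡ stepPattern k t
chain-stepPattern [] _ = 0 , z≤n , refl
chain-stepPattern (u ∷ []) _ with hasZero u
... | true = 1 , s≤s z≤n , refl
... | false = 0 , z≤n , refl
chain-stepPattern (u ∷ v ∷ c) inc with chain-stepPattern (v ∷ c) (∧-conicalʳ _ _ inc) | hasZero u in u₀
... | t , t≤k , flags | true = suc t , s≤s t≤k , cong (true ∷_) flags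
... | zero , _ , flags | false = 0 , z≤n , cong (false ∷_) flags
... | suc t , _ , flags | false
  with () ← trans (sym u₀) (hasZero-antitone u v (∧-conicalˡ _ _ inc) (cong Vec.head flags))

flagPattern-stepPattern : ∀ k s t → s ≤ k → t ≤ k → flagPattern s (stepPattern k t) ≡ (s ≡ᵇ t)
flagPattern-stepPattern zero zero zero _ _ = refl
flagPattern-stepPattern (suc k) zero zero _ _ = flagPattern-stepPattern k zero zero z≤n z≤n
flagPattern-stepPattern (suc k) zero (suc t) _ _ = refl
flagPattern-stepPattern (suc k) (suc s) zero _ _ = refl
flagPattern-stepPattern (suc k) (suc s) (suc t) (s≤s s≤k) (s≤s t≤k) = flagPattern-stepPattern k s t s≤k t≤k

≤-split : ∀ s t → 𝟙 (s ≡ᵇ t) + 𝟙 (t <ᵇ s) ≡ 𝟙 (t <ᵇ suc s)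
≤-split zero zero = refl
≤-split zero (suc t) = refl
≤-split (suc s) zero = refl
≤-split (suc s) (suc t) = ≤-split s t

∑-below : ∀ s t → ∑ (upTo s) (λ u → 𝟙 ((s ∸ suc u) ≡ᵇ t)) ≡ 𝟙 (t <ᵇ s)
∑-below zero t = refl
∑-below (suc s) t = begin
  𝟙 (s ≡ᵇ t) + ∑ (applyUpTo suc s) g      ≡⟨ cong (λ us → 𝟙 (s ≡ᵇ t) + ∑ us g) (sym (map-upTo suc s)) ⟩
  𝟙 (s ≡ᵇ t) + ∑ (map suc (upTo s)) g      ≡⟨ cong (𝟙 (s ≡ᵇ t) +_) (∑-map suc (upTo s) g) ⟩
  𝟙 (s ≡ᵇ t) + ∑ (upTo s) (λ u → g (suc u)) ≡⟨ cong (𝟙 (s ≡ᵇ t) +_) (∑-below s t) ⟩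
  𝟙 (s ≡ᵇ t) + 𝟙 (t <ᵇ s)                  ≡⟨ ≤-split s t ⟩
  𝟙 (t <ᵇ suc s)                            ∎
  where
  g : ℕ → ℕ
  g u = 𝟙 ((suc s ∸ suc u) ≡ᵇ t)

-- The indices j = i+1+u, u < k-i, of Σ_{j=i+1}^{k} correspond to k-j = (k-i)-1-u.
later-index : ∀ k i u → k ∸ (suc i + u) ≡ (k ∸ i) ∸ suc u
later-index k i u = sym (trans (∸-+-assoc k i (suc u)) (cong (k ∸_) (+-suc i u)))

stepPattern-zeroPattern : ∀ {n k} (c : Vec (Word n) k) t → t ≤ k →
  Vec.map hasZero c ≡ stepPattern k t → ∀ j → zeroPattern (k ∸ j) c ≡ ((k ∸ j) ≡ᵇ t)
stepPattern-zeroPattern {k = k} c t t≤k flags j = begin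
  zeroPattern (k ∸ j) c                    ≡⟨ zeroPattern-flags (k ∸ j) c ⟩
  flagPattern (k ∸ j) (Vec.map hasZero c)  ≡⟨ cong (flagPattern (k ∸ j)) flags ⟩
  flagPattern (k ∸ j) (stepPattern k t)    ≡⟨ flagPattern-stepPattern k (k ∸ j) t (m∸n≤m k j) t≤k ⟩
  (k ∸ j) ≡ᵇ t                             ∎

chain-weight : ∀ {n} k i → i ≤ k → (c : Vec (Word n) k) →
  𝟙 (isChain c) * columnCount zero (k ∸ i) (Vec.map hasZero c) ≡
  (k + 1) * 𝟙 (inZ i n k c) + (i + 1) * ∑ (upTo (k ∸ i)) (λ u → 𝟙 (inZ (suc i + u) n k c))
chain-weight {n} k i i≤k c with isChain c in chain
... | false = sym (cong₂ _+_ (*-zeroʳ (k + 1)) (trans (cong ((i + 1) *_) (∑-zero (upTo (k ∸ i)))) (*-zeroʳ (i + 1))))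
... | true with chain-stepPattern c (∧-conicalʳ _ _ chain)
... | t , t≤k , flags = begin
  1 * columnCount zero s (Vec.map hasZero c)
    ≡⟨ *-identityˡ _ ⟩
  columnCount zero s (Vec.map hasZero c)
    ≡⟨ cong (columnCount zero s) flags ⟩
  columnCount zero s (stepPattern k t)
    ≡⟨ columnCount-formula k zero s t (m∸n≤m k i) t≤k ⟩
  𝟙 (s ≡ᵇ t) * suc k + 𝟙 (t <ᵇ s) * suc (k ∸ s)
    ≡⟨ cong₂ _+_ (*-comm (𝟙 (s ≡ᵇ t)) (suc k)) (*-comm (𝟙 (t <ᵇ s)) (suc (k ∸ s))) ⟩
  suc k * 𝟙 (s ≡ᵇ t) + suc (k ∸ s) * 𝟙 (t <ᵇ s)
    ≡⟨ cong₂ _+_ (cong (_* 𝟙 (s ≡ᵇ t)) (+-comm 1 k))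
                 (cong (_* 𝟙 (t <ᵇ s)) (trans (cong suc (m∸[m∸n]≡n i≤k)) (+-comm 1 i))) ⟩
  (k + 1) * 𝟙 (s ≡ᵇ t) + (i + 1) * 𝟙 (t <ᵇ s)
    ≡⟨ sym (cong₂ _+_ (cong (λ b → (k + 1) * 𝟙 b) (zeroPattern≡ i)) (cong ((i + 1) *_) laterClasses)) ⟩
  (k + 1) * 𝟙 (zeroPattern s c) + (i + 1) * ∑ U (λ u → 𝟙 (zeroPattern (k ∸ (suc i + u)) c)) ∎
  where
  s = k ∸ i
  U = upTo s
  zeroPattern≡ : ∀ j → zeroPattern (k ∸ j) c ≡ ((k ∸ j) ≡ᵇ t)
  zeroPattern≡ = stepPattern-zeroPattern c t t≤k flags
  laterClasses : ∑ U (λ u → 𝟙 (zeroPattern (k ∸ (suc i + u)) c)) ≡ 𝟙 (t <ᵇ s)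
  laterClasses = trans (∑-cong U (λ u → cong 𝟙 (trans (zeroPattern≡ (suc i + u)) (cong (_≡ᵇ t) (later-index k i u)))))
                       (∑-below s t)

extensions : ∀ {m} k i → i ≤ k → (c : Vec (Word (suc m)) k) →
  ∑ (allVecs letters k) (λ x → 𝟙 (inZ i (suc (suc m)) k (extend c x))) ≡
  (k + 1) * 𝟙 (inZ i (suc m) k c) + (i + 1) * ∑ (upTo (k ∸ i)) (λ u → 𝟙 (inZ (suc i + u) (suc m) k c))
extensions k i i≤k c = begin
  ∑ X (λ x → 𝟙 (inZ i _ k (extend c x)))
    ≡⟨ ∑-cong X (λ x → trans (cong 𝟙 (chain-extend (k ∸ i) c x)) (𝟙-∧ (isChain c) _)) ⟩
  ∑ X (λ x → 𝟙 (isChain c) * 𝟙 (admissible zero (k ∸ i) (Vec.map hasZero c) x))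
    ≡⟨ ∑-* X (𝟙 (isChain c)) _ ⟩
  𝟙 (isChain c) * columnCount zero (k ∸ i) (Vec.map hasZero c)
    ≡⟨ chain-weight k i i≤k c ⟩
  _ ∎
  where
  X = allVecs letters k

recurrence-rhs : ∀ m k i → (k + 1) * z i m k + (i + 1) * sumFromTo i k (λ j → z j m k) ≡
  ∑ (allVecs (allWords m) k)
    (λ c → (k + 1) * 𝟙 (inZ i m k c) + (i + 1) * ∑ (upTo (k ∸ i)) (λ u → 𝟙 (inZ (suc i + u) m k c)))
recurrence-rhs m k i = begin
  (k + 1) * z i m k + (i + 1) * sumFromTo i k (λ j → z j m k)
    ≡⟨ cong₂ _+_ (cong ((k + 1) *_) (length-filter (inZ i m k) C)) (cong ((i + 1) *_) laterSum) ⟩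
  (k + 1) * ∑ C (λ c → 𝟙 (inZ i m k c)) + (i + 1) * ∑ C (λ c → ∑ U (λ u → 𝟙 (inZ (suc i + u) m k c)))
    ≡⟨ sym (cong₂ _+_ (∑-* C (k + 1) _) (∑-* C (i + 1) _)) ⟩
  ∑ C (λ c → (k + 1) * 𝟙 (inZ i m k c)) + ∑ C (λ c → (i + 1) * ∑ U (λ u → 𝟙 (inZ (suc i + u) m k c)))
    ≡⟨ sym (∑-+ C _ _) ⟩
  ∑ C (λ c → (k + 1) * 𝟙 (inZ i m k c) + (i + 1) * ∑ U (λ u → 𝟙 (inZ (suc i + u) m k c))) ∎
  where
  C = allVecs (allWords m) k
  U = upTo (k ∸ i)
  laterSum : sumFromTo i k (λ j → z j m k) ≡ ∑ C (λ c → ∑ U (λ u → 𝟙 (inZ (suc i + u) m k c)))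
  laterSum = trans (sum-map U _) (trans (∑-cong U (λ u → length-filter _ C)) (∑-swap U C _))

-- The recurrence: enumerate k-tuples of words of Tr(n) through their last
-- column, count the admissible columns of each chain of Tr(n-1), and reassemble
-- the sums as z_i(n-1,k) and z_j(n-1,k), j > i.
proposition3p6 : (n k i : ℕ) → 2 ≤ n → 1 ≤ k → i ≤ k →
    z i n k ≡ (k + 1) * z i (n ∸ 1) k + (i + 1) * sumFromTo i k (λ j → z j (n ∸ 1) k)
proposition3p6 (suc (suc m)) k i (s≤s (s≤s _)) _ i≤k = begin
  z i (suc (suc m)) k
    ≡⟨ length-filter (inZ i (suc (suc m)) k) (allVecs (allWords (suc (suc m))) k) ⟩
  ∑ (allVecs (allWords (suc (suc m))) k) (λ c → 𝟙 (inZ i (suc (suc m)) k c))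
    ≡⟨ ∑-tuples-extend k _ ⟩
  ∑ C (λ c → ∑ (allVecs letters k) (λ x → 𝟙 (inZ i (suc (suc m)) k (extend c x))))
    ≡⟨ ∑-cong C (extensions k i i≤k) ⟩
  ∑ C (λ c → (k + 1) * 𝟙 (inZ i (suc m) k c) + (i + 1) * ∑ (upTo (k ∸ i)) (λ u → 𝟙 (inZ (suc i + u) (suc m) k c)))
    ≡⟨ sym (recurrence-rhs (suc m) k i) ⟩
  (k + 1) * z i (suc m) k + (i + 1) * sumFromTo i k (λ j → z j (suc m) k) ∎
  where
  C = allVecs (allWords (suc m)) k
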